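{- Let $\{m\}_n = \underbrace{1 \cdots 1}_{k_0}\underbrace{0 \cdots 0}_{k_1}\cdots\underbrace{0 \cdots 0}_{k_{l-2}}\underbrace{1 \cdots 1}_{k_{l-1}}$ be a finite design (with $l$ odd, $k_0 \ge 0$, $k_i \ge 1$ for $1 \le i \le l-2$, $k_{l-1} \ge 0$, $n=\sum_{i=0}^{l-1} k_i$, $0 \le m \le 2^n-1$) and suppose $U(\{m\}_n) = \begin{pmatrix} a & b \\ c & d \end{pmatrix}$. Then: (1) $U(\{m^*\}_n) = U\big(\underbrace{1 \cdots 1}_{k_{l-1}}\underbrace{0 \cdots 0}_{k_{l-2}}\cdots\underbrace{0 \cdots 0}_{k_1}\underbrace{1 \cdots 1}_{k_0}\big) = \begin{pmatrix} d & b \\ c & a \end{pmatrix}$. (2) $U(\{2^n-(m^*+1)\}_n) = U\big(\underbrace{0 \cdots 0}_{k_{l-1}}\underbrace{1 \cdots 1}_{k_{l-2}}\cdots\underbrace{1 \cdots 1}_{k_1}\underbrace{0 \cdots 0}_{k_0}\big) = \begin{pmatrix} a & c \\ b & d \end{pmatrix}$. (3) $U(\{2^n-(m+1)\}_n) = U\big(\underbrace{0 \cdots 0}_{k_0}\underbrace{1 \cdots 1}_{k_1}\cdots\underbrace{1 \cdots 1}_{k_{l-2}}\underbrace{0 \cdots 0}_{k_{l-1}}\big) = \begin{pmatrix} d & c \\ b & a \end{pmatrix}$.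
   Context: Stern's diatomic integers $[2^n:m]$ ($0 \le m \le 2^n$) are defined by $[2^0:0]=0$, $[2^0:1]=1$, $[2^{n+1}:2m]=[2^n:m]$, $[2^{n+1}:2m+1]=[2^n:m]+[2^n:m+1]$. For $0 \le m \le 2^n-1$, the design $\{m\}_n$ is the length-$n$ binary word $d_1\cdots d_n$ with $\sum_{i=1}^n 2^{n-i}d_i = m$, and one writes $[\{m\}_n]=[2^n:m]$. The Stern's diatomic matrix is $U(\{m\}_n)=U(2^n:m)=\begin{pmatrix} [2^n:m+1] & [2^n:m] \\ [2^n:2^n-(m+1)] & [2^n:2^n-m] \end{pmatrix}$. For a finite design $D=\underbrace{1 \cdots 1}_{k_0}\underbrace{0 \cdots 0}_{k_1}\cdots\underbrace{0 \cdots 0}_{k_{l-2}}\underbrace{1 \cdots 1}_{k_{l-1}}$ ($l$ odd, $k_0 \ge 0$, $k_i\ge1$ for $1\le i\le l-2$, $k_{l-1}\ge 0$), its inverse design is $D^*=\underbrace{1 \cdots 1}_{k_{l-1}}\underbrace{0 \cdots 0}_{k_{l-2}}\cdots\underbrace{0 \cdots 0}_{k_1}\underbrace{1 \cdots 1}_{k_0}$; if $D=\{m\}_n$ one writes $D^*=\{m^*\}_n$. Also $\{2^n - m'\}_n$ denotes the design of $2^n-m'$ with length $n$. -}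

module Defs where

open import Data.Nat using (ℕ; zero; suc; _+_; _*_; _∸_; _^_; _≤_)
open import Data.Nat.DivMod using (_/_; _%_)
open import Data.Bool using (Bool; true; false; not)
open import Data.List using (List; []; _∷_; _++_; replicate; foldl; length)
open import Data.Vec using (Vec; toList)

-- Stern's diatomic integers: stern n m = [2^n : m]  (meaningful for 0 ≤ m ≤ 2^n).
--   [2^0:0] = 0, [2^0:1] = 1,
--   [2^(n+1):2m] = [2^n:m],  [2^(n+1):2m+1] = [2^n:m] + [2^n:m+1].
-- Values outside 0 ≤ m ≤ 2^n are junk (never used by the statement).
stern : ℕ → ℕ → ℕ
stern zero zero = 0
stern zero (suc zero) = 1
stern zero (suc (suc _)) = 0
stern (suc n) m with m % 2
... | zero  = stern n (m / 2)
... | suc _ = stern n (m / 2) + stern n (suc (m / 2))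

record Mat2 : Set where
  constructor mat
  field
    e11 e12 e21 e22 : ℕ

Um : ℕ → ℕ → Mat2
Um n m = mat (stern n (suc m)) (stern n m)
             (stern n (2 ^ n ∸ suc m)) (stern n (2 ^ n ∸ m))

Design : Set
Design = List Bool

bit : Bool → ℕ
bit true = 1
bit false = 0

-- value Σ 2^(n-i) dᵢ (big-endian), so that D = {value D}_(length D).
value : Design → ℕ
value = foldl (λ acc d → 2 * acc + bit d) 0

U : Design → Mat2
U D = Um (length D) (value D)

blocks : Bool → List ℕ → Design
blocks b [] = []
blocks b (k ∷ ks) = replicate k b ++ blocks (not b) ks

blocksV : ∀ {l} → Bool → Vec ℕ l → Design
blocksV b ks = blocks b (toList ks)

-- Reading a design d₁ ⋯ dₙ from left to right, appending the bit d to the binary expansion of m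
-- multiplies the row vector ([2^n:m], [2^n:m+1]) on the right by P d, where P 0 = (1 1 ; 0 1) and
-- P 1 = (1 0 ; 1 1). Hence ([2^n:m], [2^n:m+1]) is the bottom row of M D = P d₁ ⋯ P dₙ, and since
-- the complementary design has value 2^n − (m+1), U(D) is M D rotated by 180°. Complementing every bit
-- swaps P 0 and P 1, i.e. rotates M D; reversing the word reverses the product, and P d is invariant
-- under rotation followed by transposition. A design with an odd number of blocks starting with 1 also
-- ends with 1, so reversing its block lengths reverses the word, and the three identities follow.
module Submission where

open import Defs
open import Data.Nat using (ℕ; zero; suc; _+_; _*_; _∸_; _^_; _≤_)
open import Data.Nat.Properties using (+-comm; *-comm; +-suc; +-identityʳ; *-identityˡ; *-identityʳ; m+n∸n≡m)
open import Data.Nat.DivMod using (_/_; _%_; m*n%n≡0; m*n/n≡m; [m+kn]%n≡m%n; +-distrib-/-∣ʳ)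
open import Data.Nat.Divisibility using (divides)
open import Data.Nat.GeneralisedArithmetic using (iterate)
open import Data.Nat.Tactic.RingSolver using (solve-∀)
open import Data.Bool using (Bool; true; false; not)
open import Data.Bool.Properties using (not-involutive)
open import Data.Fin using (Fin; toℕ)
open import Data.Vec using (Vec; lookup; reverse; sum; toList)
import Data.Vec as Vec
open import Data.Vec.Properties using (toList-reverse; length-toList)
open import Data.List using ([]; _∷_; _++_; _∷ʳ_; replicate; foldl; length; map)
import Data.List as List
open import Data.List.Properties
  using (map-++; map-replicate; length-map; length-++; length-replicate; length-reverse;
         ++-assoc; ++-identityʳ; unfold-reverse; reverse-++)
open import Data.Product using (_×_; _,_; proj₁; proj₂)
open import Function using (_∘_)
open import Relation.Binary.PropositionalEquality
open ≡-Reasoning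

private
  double%2 : ∀ v → (2 * v) % 2 ≡ 0
  double%2 v = trans (cong (_% 2) (*-comm 2 v)) (m*n%n≡0 v 2)

  double/2 : ∀ v → (2 * v) / 2 ≡ v
  double/2 v = trans (cong (_/ 2) (*-comm 2 v)) (m*n/n≡m v 2)

  double+1%2 : ∀ v → (1 + 2 * v) % 2 ≡ 1
  double+1%2 v = trans (cong (λ w → (1 + w) % 2) (*-comm 2 v)) ([m+kn]%n≡m%n 1 v 2)

  double+1/2 : ∀ v → (1 + 2 * v) / 2 ≡ v
  double+1/2 v = begin
    (1 + 2 * v) / 2  ≡⟨ +-distrib-/-∣ʳ 1 {2 * v} {2} (divides v (*-comm 2 v)) ⟩
    0 + (2 * v) / 2  ≡⟨ double/2 v ⟩
    v                ∎

stern-double : ∀ n v → stern (suc n) (2 * v) ≡ stern n v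
stern-double n v rewrite double%2 v | double/2 v = refl

stern-double+1 : ∀ n v → stern (suc n) (2 * v + 1) ≡ stern n v + stern n (suc v)
stern-double+1 n v rewrite +-comm (2 * v) 1 | double+1%2 v | double+1/2 v = refl

cong-mat : ∀ {a b c d a′ b′ c′ d′} → a ≡ a′ → b ≡ b′ → c ≡ c′ → d ≡ d′ → mat a b c d ≡ mat a′ b′ c′ d′
cong-mat refl refl refl refl = refl

infixl 7 _·_
_·_ : Mat2 → Mat2 → Mat2
mat a b c d · mat e f g h = mat (a * e + b * g) (a * f + b * h) (c * e + d * g) (c * f + d * h)

I : Mat2
I = mat 1 0 0 1

rotate : Mat2 → Mat2
rotate (mat a b c d) = mat d c b a

transpose : Mat2 → Mat2
transpose (mat a b c d) = mat a c b d

bottomRow : Mat2 → ℕ × ℕ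
bottomRow (mat a b c d) = c , d

infixl 7 _⊙_
_⊙_ : ℕ × ℕ → Mat2 → ℕ × ℕ
(x , y) ⊙ mat a b c d = x * a + y * c , x * b + y * d

private
  dot-assoc : ∀ (x a y c e b d g : ℕ) →
              (x * a + y * c) * e + (x * b + y * d) * g ≡ x * (a * e + b * g) + y * (c * e + d * g)
  dot-assoc = solve-∀

  dot-comm : ∀ (x y z w : ℕ) → x * y + z * w ≡ z * w + x * y
  dot-comm = solve-∀

  dot-swap : ∀ (x y z w : ℕ) → x * y + z * w ≡ y * x + w * z
  dot-swap = solve-∀

  dot-unitʳ : ∀ (x y : ℕ) → x * 1 + y * 0 ≡ x
  dot-unitʳ = solve-∀

  dot-unitˡ : ∀ (x y : ℕ) → 1 * x + 0 * y ≡ x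
  dot-unitˡ = solve-∀

  dot-unit₂ʳ : ∀ (x y : ℕ) → x * 0 + y * 1 ≡ y
  dot-unit₂ʳ = solve-∀

  dot-ones : ∀ (x y : ℕ) → x * 1 + y * 1 ≡ x + y
  dot-ones = solve-∀

·-assoc : ∀ A B C → (A · B) · C ≡ A · (B · C)
·-assoc (mat a b c d) (mat e f g h) (mat i j k l) =
  cong-mat (dot-assoc a e b g i f h k) (dot-assoc a e b g j f h l)
           (dot-assoc c e d g i f h k) (dot-assoc c e d g j f h l)

·-identityˡ : ∀ A → I · A ≡ A
·-identityˡ (mat a b c d) =
  cong-mat (dot-unitˡ a c) (dot-unitˡ b d) (+-identityʳ c) (+-identityʳ d)

⊙-·-assoc : ∀ r A B → r ⊙ A ⊙ B ≡ r ⊙ (A · B)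
⊙-·-assoc (x , y) (mat a b c d) (mat e f g h) =
  cong₂ _,_ (dot-assoc x a y c e b d g) (dot-assoc x a y c f b d h)

⊙-identityʳ : ∀ r → r ⊙ I ≡ r
⊙-identityʳ (x , y) = cong₂ _,_ (dot-unitʳ x y) (dot-unit₂ʳ x y)

⊙-bottomRow : ∀ A → (0 , 1) ⊙ A ≡ bottomRow A
⊙-bottomRow (mat a b c d) = cong₂ _,_ (+-identityʳ c) (+-identityʳ d)

rotate-· : ∀ A B → rotate (A · B) ≡ rotate A · rotate B
rotate-· (mat a b c d) (mat e f g h) =
  cong-mat (dot-comm c f d h) (dot-comm c e d g) (dot-comm a f b h) (dot-comm a e b g)

transpose-· : ∀ A B → transpose (A · B) ≡ transpose B · transpose A
transpose-· (mat a b c d) (mat e f g h) =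
  cong-mat (dot-swap a e b g) (dot-swap c e d g) (dot-swap a f b h) (dot-swap c f d h)

bitMatrix : Bool → Mat2
bitMatrix false = mat 1 1 0 1
bitMatrix true  = mat 1 0 1 1

rotate-bitMatrix : ∀ d → rotate (bitMatrix d) ≡ bitMatrix (not d)
rotate-bitMatrix false = refl
rotate-bitMatrix true  = refl

transpose-rotate-bitMatrix : ∀ d → transpose (rotate (bitMatrix d)) ≡ bitMatrix d
transpose-rotate-bitMatrix false = refl
transpose-rotate-bitMatrix true  = refl

designMatrix : Design → Mat2
designMatrix []      = I
designMatrix (d ∷ D) = bitMatrix d · designMatrix D

designMatrix-++ : ∀ D E → designMatrix (D ++ E) ≡ designMatrix D · designMatrix E
designMatrix-++ []      E = sym (·-identityˡ (designMatrix E))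
designMatrix-++ (d ∷ D) E = begin
  bitMatrix d · designMatrix (D ++ E)             ≡⟨ cong (bitMatrix d ·_) (designMatrix-++ D E) ⟩
  bitMatrix d · (designMatrix D · designMatrix E) ≡⟨ ·-assoc (bitMatrix d) (designMatrix D) (designMatrix E) ⟨
  bitMatrix d · designMatrix D · designMatrix E   ∎

designMatrix-map-not : ∀ D → designMatrix (map not D) ≡ rotate (designMatrix D)
designMatrix-map-not []      = refl
designMatrix-map-not (d ∷ D) = begin
  bitMatrix (not d) · designMatrix (map not D)   ≡⟨ cong₂ _·_ (sym (rotate-bitMatrix d)) (designMatrix-map-not D) ⟩
  rotate (bitMatrix d) · rotate (designMatrix D) ≡⟨ rotate-· (bitMatrix d) (designMatrix D) ⟨
  rotate (bitMatrix d · designMatrix D)          ∎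

designMatrix-reverse : ∀ D → designMatrix (List.reverse D) ≡ transpose (rotate (designMatrix D))
designMatrix-reverse []      = refl
designMatrix-reverse (d ∷ D) = begin
  designMatrix (List.reverse (d ∷ D))
    ≡⟨ cong designMatrix (unfold-reverse d D) ⟩
  designMatrix (List.reverse D ∷ʳ d)
    ≡⟨ designMatrix-++ (List.reverse D) (d ∷ []) ⟩
  designMatrix (List.reverse D) · (bitMatrix d · I)
    ≡⟨ cong₂ _·_ (designMatrix-reverse D) (trans (bitMatrix-·-I d) (sym (transpose-rotate-bitMatrix d))) ⟩
  transpose (rotate (designMatrix D)) · transpose (rotate (bitMatrix d))
    ≡⟨ transpose-· (rotate (bitMatrix d)) (rotate (designMatrix D)) ⟨
  transpose (rotate (bitMatrix d) · rotate (designMatrix D))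
    ≡⟨ cong transpose (rotate-· (bitMatrix d) (designMatrix D)) ⟨
  transpose (rotate (bitMatrix d · designMatrix D))
    ∎
  where
  bitMatrix-·-I : ∀ d → bitMatrix d · I ≡ bitMatrix d
  bitMatrix-·-I false = refl
  bitMatrix-·-I true  = refl

sternPair : ℕ → ℕ → ℕ × ℕ
sternPair n v = stern n v , stern n (suc v)

push : ℕ → Bool → ℕ
push acc d = 2 * acc + bit d

sternPair-push : ∀ n v d → sternPair (suc n) (push v d) ≡ sternPair n v ⊙ bitMatrix d
sternPair-push n v false = cong₂ _,_
  (begin
    stern (suc n) (2 * v + 0) ≡⟨ cong (stern (suc n)) (+-identityʳ (2 * v)) ⟩
    stern (suc n) (2 * v)     ≡⟨ stern-double n v ⟩
    stern n v                 ≡⟨ dot-unitʳ (stern n v) (stern n (suc v)) ⟨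
    _                         ∎)
  (begin
    stern (suc n) (suc (2 * v + 0))     ≡⟨ cong (stern (suc n)) (even-succ v) ⟩
    stern (suc n) (2 * v + 1)           ≡⟨ stern-double+1 n v ⟩
    stern n v + stern n (suc v)         ≡⟨ dot-ones (stern n v) (stern n (suc v)) ⟨
    _                                   ∎)
  where
  even-succ : ∀ v → suc (2 * v + 0) ≡ 2 * v + 1
  even-succ = solve-∀
sternPair-push n v true = cong₂ _,_
  (begin
    stern (suc n) (2 * v + 1)   ≡⟨ stern-double+1 n v ⟩
    stern n v + stern n (suc v) ≡⟨ dot-ones (stern n v) (stern n (suc v)) ⟨
    _                           ∎)
  (begin
    stern (suc n) (suc (2 * v + 1)) ≡⟨ cong (stern (suc n)) (odd-succ v) ⟩
    stern (suc n) (2 * suc v)       ≡⟨ stern-double n (suc v) ⟩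
    stern n (suc v)                 ≡⟨ dot-unit₂ʳ (stern n v) (stern n (suc v)) ⟨
    _                               ∎)
  where
  odd-succ : ∀ v → suc (2 * v + 1) ≡ 2 * suc v
  odd-succ = solve-∀

sternPair-foldl : ∀ D n v → sternPair (n + length D) (foldl push v D) ≡ sternPair n v ⊙ designMatrix D
sternPair-foldl []      n v rewrite +-identityʳ n = sym (⊙-identityʳ (sternPair n v))
sternPair-foldl (d ∷ D) n v rewrite +-suc n (length D) = begin
  sternPair (suc n + length D) (foldl push (push v d) D) ≡⟨ sternPair-foldl D (suc n) (push v d) ⟩
  sternPair (suc n) (push v d) ⊙ designMatrix D         ≡⟨ cong (_⊙ designMatrix D) (sternPair-push n v d) ⟩
  sternPair n v ⊙ bitMatrix d ⊙ designMatrix D          ≡⟨ ⊙-·-assoc (sternPair n v) (bitMatrix d) (designMatrix D) ⟩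
  sternPair n v ⊙ designMatrix (d ∷ D)                  ∎

sternPair-value : ∀ D → sternPair (length D) (value D) ≡ bottomRow (designMatrix D)
sternPair-value D = trans (sternPair-foldl D 0 0) (⊙-bottomRow (designMatrix D))

foldl-push-complement : ∀ D a b →
  foldl push a (map not D) + foldl push b D + 1 ≡ 2 ^ length D * (a + b + 1)
foldl-push-complement []      a b = sym (*-identityˡ (a + b + 1))
foldl-push-complement (d ∷ D) a b = begin
  foldl push (push a (not d)) (map not D) + foldl push (push b d) D + 1
    ≡⟨ foldl-push-complement D (push a (not d)) (push b d) ⟩
  2 ^ length D * (push a (not d) + push b d + 1)
    ≡⟨ cong (2 ^ length D *_) (push-complement d) ⟩
  2 ^ length D * (2 * (a + b + 1))
    ≡⟨ regroup (2 ^ length D) (a + b + 1) ⟩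
  2 ^ length (d ∷ D) * (a + b + 1)
    ∎
  where
  push-complement : ∀ d → push a (not d) + push b d + 1 ≡ 2 * (a + b + 1)
  push-complement false = odd+even a b
    where
    odd+even : ∀ (a b : ℕ) → 2 * a + 1 + (2 * b + 0) + 1 ≡ 2 * (a + b + 1)
    odd+even = solve-∀
  push-complement true = even+odd a b
    where
    even+odd : ∀ (a b : ℕ) → 2 * a + 0 + (2 * b + 1) + 1 ≡ 2 * (a + b + 1)
    even+odd = solve-∀
  regroup : ∀ (t k : ℕ) → t * (2 * k) ≡ 2 * t * k
  regroup = solve-∀

value-complement : ∀ D → value (map not D) + value D + 1 ≡ 2 ^ length D
value-complement D = trans (foldl-push-complement D 0 0) (*-identityʳ (2 ^ length D))

∸-value-suc : ∀ D → 2 ^ length D ∸ suc (value D) ≡ value (map not D)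
∸-value-suc D = begin
  2 ^ length D ∸ suc (value D)                      ≡⟨ cong (_∸ suc (value D)) (value-complement D) ⟨
  value (map not D) + value D + 1 ∸ suc (value D)   ≡⟨ cong (_∸ suc (value D)) (+-comm _ 1) ⟩
  suc (value (map not D) + value D) ∸ suc (value D) ≡⟨ m+n∸n≡m (value (map not D)) (value D) ⟩
  value (map not D)                                 ∎

∸-value : ∀ D → 2 ^ length D ∸ value D ≡ suc (value (map not D))
∸-value D = begin
  2 ^ length D ∸ value D                      ≡⟨ cong (_∸ value D) (value-complement D) ⟨
  value (map not D) + value D + 1 ∸ value D   ≡⟨ cong (_∸ value D) (move-one (value (map not D)) (value D)) ⟩
  suc (value (map not D)) + value D ∸ value D ≡⟨ m+n∸n≡m (suc (value (map not D))) (value D) ⟩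
  suc (value (map not D))                     ∎
  where
  move-one : ∀ (w v : ℕ) → w + v + 1 ≡ suc w + v
  move-one = solve-∀

sternPair-map-not : ∀ D → sternPair (length D) (value (map not D)) ≡ bottomRow (rotate (designMatrix D))
sternPair-map-not D = begin
  sternPair (length D) (value (map not D))           ≡⟨ cong (λ k → sternPair k (value (map not D))) (length-map not D) ⟨
  sternPair (length (map not D)) (value (map not D)) ≡⟨ sternPair-value (map not D) ⟩
  bottomRow (designMatrix (map not D))               ≡⟨ cong bottomRow (designMatrix-map-not D) ⟩
  bottomRow (rotate (designMatrix D))                ∎

U-rotate-designMatrix : ∀ D → U D ≡ rotate (designMatrix D)
U-rotate-designMatrix D with designMatrix D in eq
... | mat p q r s = cong-mat
  (cong proj₂ top) (cong proj₁ top)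
  (trans (cong (stern (length D)) (∸-value-suc D)) (cong proj₁ bottom))
  (trans (cong (stern (length D)) (∸-value D)) (cong proj₂ bottom))
  where
  top : sternPair (length D) (value D) ≡ (r , s)
  top = trans (sternPair-value D) (cong bottomRow eq)
  bottom : sternPair (length D) (value (map not D)) ≡ (q , p)
  bottom = trans (sternPair-map-not D) (cong (bottomRow ∘ rotate) eq)

U-map-not : ∀ D → U (map not D) ≡ rotate (U D)
U-map-not D = begin
  U (map not D)                        ≡⟨ U-rotate-designMatrix (map not D) ⟩
  rotate (designMatrix (map not D))    ≡⟨ cong rotate (designMatrix-map-not D) ⟩
  rotate (rotate (designMatrix D))     ≡⟨ cong rotate (U-rotate-designMatrix D) ⟨
  rotate (U D)                         ∎

U-reverse : ∀ D → U (List.reverse D) ≡ rotate (transpose (U D))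
U-reverse D = begin
  U (List.reverse D)                           ≡⟨ U-rotate-designMatrix (List.reverse D) ⟩
  rotate (designMatrix (List.reverse D))       ≡⟨ cong rotate (designMatrix-reverse D) ⟩
  rotate (transpose (rotate (designMatrix D))) ≡⟨ cong (rotate ∘ transpose) (U-rotate-designMatrix D) ⟨
  rotate (transpose (U D))                     ∎

Um-complement : ∀ D → Um (length D) (2 ^ length D ∸ suc (value D)) ≡ U (map not D)
Um-complement D = begin
  Um (length D) (2 ^ length D ∸ suc (value D)) ≡⟨ cong (Um (length D)) (∸-value-suc D) ⟩
  Um (length D) (value (map not D))            ≡⟨ cong (λ k → Um k (value (map not D))) (length-map not D) ⟨
  U (map not D)                                ∎

U-design-symmetries : ∀ D {a b c d} → U D ≡ mat a b c d →
    ((Um (length D) (value (List.reverse D)) ≡ U (List.reverse D))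
    × (U (List.reverse D) ≡ mat d b c a))
  × ((Um (length D) (2 ^ length D ∸ suc (value (List.reverse D))) ≡ U (map not (List.reverse D)))
    × (U (map not (List.reverse D)) ≡ mat a c b d))
  × ((Um (length D) (2 ^ length D ∸ suc (value D)) ≡ U (map not D))
    × (U (map not D) ≡ mat d c b a))
U-design-symmetries D {a} {b} {c} {d} UD =
    (cong (λ k → Um k (value R)) (sym (length-reverse D)) , U-R)
  , (trans (cong (λ k → Um k (2 ^ k ∸ suc (value R))) (sym (length-reverse D))) (Um-complement R)
    , trans (U-map-not R) (cong rotate U-R))
  , (Um-complement D , trans (U-map-not D) (cong rotate UD))
  where
  R : Design
  R = List.reverse D
  U-R : U R ≡ mat d b c a
  U-R = trans (U-reverse D) (cong (rotate ∘ transpose) UD)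

blocks-not : ∀ b ks → blocks (not b) ks ≡ map not (blocks b ks)
blocks-not b []       = refl
blocks-not b (k ∷ ks) = begin
  replicate k (not b) ++ blocks (not (not b)) ks        ≡⟨ cong₂ _++_ (sym (map-replicate not k b)) (blocks-not (not b) ks) ⟩
  map not (replicate k b) ++ map not (blocks (not b) ks) ≡⟨ map-++ not (replicate k b) (blocks (not b) ks) ⟨
  map not (replicate k b ++ blocks (not b) ks)           ∎

length-blocksV : ∀ {l} b (ks : Vec ℕ l) → length (blocksV b ks) ≡ sum ks
length-blocksV b Vec.[]       = refl
length-blocksV b (k Vec.∷ ks) =
  trans (length-++ (replicate k b)) (cong₂ _+_ (length-replicate k) (length-blocksV (not b) ks))

iterate-not-not : ∀ n b → iterate not (not b) n ≡ not (iterate not b n)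
iterate-not-not zero    b = refl
iterate-not-not (suc n) b = iterate-not-not n (not b)

iterate-not-+ : ∀ m n b → iterate not b (m + n) ≡ iterate not (iterate not b m) n
iterate-not-+ zero    n b = refl
iterate-not-+ (suc m) n b = iterate-not-+ m n (not b)

iterate-not-involutive : ∀ n b → iterate not (iterate not b n) n ≡ b
iterate-not-involutive zero    b = refl
iterate-not-involutive (suc n) b = begin
  iterate not (iterate not (not b) n) (suc n)   ≡⟨ iterate-not-not n (iterate not (not b) n) ⟩
  not (iterate not (iterate not (not b) n) n)   ≡⟨ cong not (iterate-not-involutive n (not b)) ⟩
  not (not b)                                   ≡⟨ not-involutive b ⟩
  b                                             ∎

iterate-not-odd : ∀ j b → iterate not b (suc (2 * j)) ≡ not b
iterate-not-odd j b = begin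
  iterate not (not b) (j + (j + 0))        ≡⟨ cong (iterate not (not b) ∘ (j +_)) (+-identityʳ j) ⟩
  iterate not (not b) (j + j)              ≡⟨ iterate-not-+ j j (not b) ⟩
  iterate not (iterate not (not b) j) j    ≡⟨ iterate-not-involutive j (not b) ⟩
  not b                                    ∎

blocks-∷ʳ : ∀ b ks k → blocks b (ks ∷ʳ k) ≡ blocks b ks ++ replicate k (iterate not b (length ks))
blocks-∷ʳ b []       k = ++-identityʳ (replicate k b)
blocks-∷ʳ b (k′ ∷ ks) k = begin
  replicate k′ b ++ blocks (not b) (ks ∷ʳ k)
    ≡⟨ cong (replicate k′ b ++_) (blocks-∷ʳ (not b) ks k) ⟩
  replicate k′ b ++ (blocks (not b) ks ++ replicate k (iterate not (not b) (length ks)))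
    ≡⟨ ++-assoc (replicate k′ b) (blocks (not b) ks) _ ⟨
  (replicate k′ b ++ blocks (not b) ks) ++ replicate k (iterate not (not b) (length ks))
    ∎

reverse-replicate : ∀ k (x : Bool) → List.reverse (replicate k x) ≡ replicate k x
reverse-replicate zero    x = refl
reverse-replicate (suc k) x = begin
  List.reverse (x ∷ replicate k x) ≡⟨ unfold-reverse x (replicate k x) ⟩
  List.reverse (replicate k x) ∷ʳ x ≡⟨ cong (_∷ʳ x) (reverse-replicate k x) ⟩
  replicate k x ∷ʳ x                ≡⟨ replicate-∷ʳ k ⟩
  x ∷ replicate k x                 ∎
  where
  replicate-∷ʳ : ∀ k → replicate k x ∷ʳ x ≡ x ∷ replicate k x
  replicate-∷ʳ zero    = refl
  replicate-∷ʳ (suc k) = cong (x ∷_) (replicate-∷ʳ k)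

-- The last block of blocks b ks has colour iterate not b (length ks − 1).
reverse-blocks : ∀ b ks → List.reverse (blocks b ks) ≡ blocks (not (iterate not b (length ks))) (List.reverse ks)
reverse-blocks b []       = refl
reverse-blocks b (k ∷ ks) = begin
  List.reverse (replicate k b ++ blocks (not b) ks)
    ≡⟨ reverse-++ (replicate k b) (blocks (not b) ks) ⟩
  List.reverse (blocks (not b) ks) ++ List.reverse (replicate k b)
    ≡⟨ cong₂ _++_ (reverse-blocks (not b) ks) (reverse-replicate k b) ⟩
  blocks c (List.reverse ks) ++ replicate k b
    ≡⟨ cong (λ x → blocks c (List.reverse ks) ++ replicate k x) last-colour ⟨
  blocks c (List.reverse ks) ++ replicate k (iterate not c (length (List.reverse ks)))
    ≡⟨ blocks-∷ʳ c (List.reverse ks) k ⟨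
  blocks c (List.reverse ks ∷ʳ k)
    ≡⟨ cong (blocks c) (unfold-reverse k ks) ⟨
  blocks c (List.reverse (k ∷ ks))
    ∎
  where
  c : Bool
  c = not (iterate not (not b) (length ks))
  last-colour : iterate not c (length (List.reverse ks)) ≡ b
  last-colour = begin
    iterate not c (length (List.reverse ks))      ≡⟨ cong (iterate not c) (length-reverse ks) ⟩
    iterate not c (length ks)                     ≡⟨ cong (λ x → iterate not (not x) (length ks)) (iterate-not-not (length ks) b) ⟩
    iterate not (not (not (iterate not b (length ks)))) (length ks)
      ≡⟨ cong (λ x → iterate not x (length ks)) (not-involutive _) ⟩
    iterate not (iterate not b (length ks)) (length ks) ≡⟨ iterate-not-involutive (length ks) b ⟩
    b                                             ∎

reverse-blocksV-odd : ∀ j b (ks : Vec ℕ (suc (2 * j))) → blocksV b (reverse ks) ≡ List.reverse (blocksV b ks)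
reverse-blocksV-odd j b ks = begin
  blocks b (toList (reverse ks))
    ≡⟨ cong₂ blocks (sym first-colour) (toList-reverse ks) ⟩
  blocks (not (iterate not b (length (toList ks)))) (List.reverse (toList ks))
    ≡⟨ reverse-blocks b (toList ks) ⟨
  List.reverse (blocks b (toList ks))
    ∎
  where
  first-colour : not (iterate not b (length (toList ks))) ≡ b
  first-colour = begin
    not (iterate not b (length (toList ks))) ≡⟨ cong (not ∘ iterate not b) (length-toList ks) ⟩
    not (iterate not b (suc (2 * j)))        ≡⟨ cong not (iterate-not-odd j b) ⟩
    not (not b)                              ≡⟨ not-involutive b ⟩
    b                                        ∎

theorem5p6 : (j : ℕ) (ks : Vec ℕ (suc (2 * j)))
    → (∀ (i : Fin (suc (2 * j))) → 1 ≤ toℕ i → toℕ i + 2 ≤ suc (2 * j) → 1 ≤ lookup ks i)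
    → (n m : ℕ) → n ≡ sum ks → m ≡ value (blocksV true ks)
    → (a b c d : ℕ) → U (blocksV true ks) ≡ mat a b c d
    → ((Um n (value (blocksV true (reverse ks))) ≡ U (blocksV true (reverse ks)))
        × (U (blocksV true (reverse ks)) ≡ mat d b c a))
      × ((Um n (2 ^ n ∸ suc (value (blocksV true (reverse ks)))) ≡ U (blocksV false (reverse ks)))
        × (U (blocksV false (reverse ks)) ≡ mat a c b d))
      × ((Um n (2 ^ n ∸ suc m) ≡ U (blocksV false ks))
        × (U (blocksV false ks) ≡ mat d c b a))
theorem5p6 j ks _ n m refl refl a b c d UD
  rewrite sym (length-blocksV true ks)
        | blocks-not true (toList ks)
        | blocks-not true (toList (reverse ks))
        | reverse-blocksV-odd j true ks
  = U-design-symmetries (blocksV true ks) UD
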